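{- If $G$ is a curious graph of type $0$ or $1$ with respect to a partition $(V_1,V_2,V_3)$, then (after suitably renaming the three parts $V_1,V_2,V_3$) $G$ can be partitioned into slices that are bipartite.
   Context: A graph $G$ is curious with respect to a partition $(V_1,V_2,V_3)$ of its vertex set into three (possibly empty) independent sets if there are no $x\in V_1,y\in V_2,z\in V_3$ with $G[\{x,y,z\}]$ a triangle or edgeless. It is of type $t$ (with respect to this partition) if exactly $t$ of the graphs $G[V_1\cup V_2]$, $G[V_1\cup V_3]$, $G[V_2\cup V_3]$ contain an induced $2P_2$ (two disjoint edges). $G$ can be partitioned into slices (with respect to $(V_1,V_2,V_3)$) if each $V_i$ can be partitioned into $V_i^0,\dots,V_i^\ell$ such that, with subscripts of the $V_i$ modulo $3$, for each $i$ and all $j<k$, $V_i^j$ is complete to $V_{i+1}^k$ and anti-complete to $V_{i+2}^k$; the slices are $G^j=G[V_1^j\cup V_2^j\cup V_3^j]$. -}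

module Defs where

open import Data.Nat using (ℕ; _<_; _+_)
open import Data.Fin using (Fin; zero; suc)
open import Data.Bool using (Bool; true; false)
open import Data.Product using (Σ; _×_; ∃; ∃-syntax)
open import Relation.Binary.PropositionalEquality using (_≡_; _≢_)
open import Relation.Nullary using (¬_)
open import Function.Bundles using (_⇔_)
open import Data.Fin.Permutation using (Permutation′; _⟨$⟩ʳ_)

record Graph (n : ℕ) : Set where
  field
    adj   : Fin n → Fin n → Bool
    sym   : ∀ x y → adj x y ≡ adj y x
    irrfl : ∀ x → adj x x ≡ false

open Graph public

Edge : ∀ {n} → Graph n → Fin n → Fin n → Set
Edge G x y = adj G x y ≡ true

-- A partition (V₁,V₂,V₃) of the vertex set into three (possibly empty) parts,
-- given by assigning to each vertex its part; part 0 ↦ V₁, 1 ↦ V₂, 2 ↦ V₃.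
Partition3 : ℕ → Set
Partition3 n = Fin n → Fin 3

IndependentParts : ∀ {n} → Graph n → Partition3 n → Set
IndependentParts G p = ∀ x y → p x ≡ p y → ¬ Edge G x y

i₁ i₂ i₃ : Fin 3
i₁ = zero
i₂ = suc zero
i₃ = suc (suc zero)

Triangle : ∀ {n} → Graph n → Fin n → Fin n → Fin n → Set
Triangle G x y z = Edge G x y × Edge G x z × Edge G y z

Edgeless3 : ∀ {n} → Graph n → Fin n → Fin n → Fin n → Set
Edgeless3 G x y z = ¬ Edge G x y × ¬ Edge G x z × ¬ Edge G y z

Curious : ∀ {n} → Graph n → Partition3 n → Set
Curious G p =
  IndependentParts G p ×
  (∀ x y z → p x ≡ i₁ → p y ≡ i₂ → p z ≡ i₃ →
     ¬ Triangle G x y z × ¬ Edgeless3 G x y z)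

InPair : ∀ {n} → Partition3 n → Fin 3 → Fin 3 → Fin n → Set
InPair p a b v = (p v ≡ a) Data.Sum.⊎ (p v ≡ b)
  where import Data.Sum

Induced2P2 : ∀ {n} → Graph n → Partition3 n → Fin 3 → Fin 3 → Set
Induced2P2 G p a b =
  ∃[ w ] ∃[ x ] ∃[ y ] ∃[ z ]
    (InPair p a b w × InPair p a b x × InPair p a b y × InPair p a b z) ×
    (w ≢ x × w ≢ y × w ≢ z × x ≢ y × x ≢ z × y ≢ z) ×
    (Edge G w x × Edge G y z) ×
    (¬ Edge G w y × ¬ Edge G w z × ¬ Edge G x y × ¬ Edge G x z)

pairA pairB : Fin 3 → Fin 3
pairA zero = i₁
pairA (suc zero) = i₁
pairA (suc (suc zero)) = i₂
pairB zero = i₂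
pairB (suc zero) = i₃
pairB (suc (suc zero)) = i₃

bit : Bool → ℕ
bit true = 1
bit false = 0

OfType : ∀ {n} → Graph n → Partition3 n → ℕ → Set
OfType G p t =
  Σ (Fin 3 → Bool) λ b →
    (∀ k → (b k ≡ true) ⇔ Induced2P2 G p (pairA k) (pairB k)) ×
    (bit (b zero) + bit (b (suc zero)) + bit (b (suc (suc zero))) ≡ t)

next : Fin 3 → Fin 3
next zero = suc zero
next (suc zero) = suc (suc zero)
next (suc (suc zero)) = zero

-- G can be partitioned into slices w.r.t. partition p: vertex v lies in
-- V_{p v}^{s v}; for j<k, V_i^j complete to V_{i+1}^k, anticomplete to V_{i+2}^k.
SliceAssignment : ∀ {n} → Graph n → Partition3 n → (Fin n → ℕ) → Set
SliceAssignment G p s =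
  ∀ x y → s x < s y →
    (p y ≡ next (p x) → Edge G x y) ×
    (p y ≡ next (next (p x)) → ¬ Edge G x y)

SlicesBipartite : ∀ {n} → Graph n → (Fin n → ℕ) → Set
SlicesBipartite {n} G s =
  ∀ (j : ℕ) → Σ (Fin n → Bool) λ c →
    ∀ (x y : Fin n) → s x ≡ j → s y ≡ j → Edge G x y → c x ≢ c y

BipartiteSlicing : ∀ {n} → Graph n → Partition3 n → Set
BipartiteSlicing {n} G p =
  Σ (Permutation′ 3) λ σ → Σ (Fin n → ℕ) λ s →
    SliceAssignment G (λ v → σ ⟨$⟩ʳ p v) s × SlicesBipartite G s

-- Orient every pair of vertices in different parts: x ⇒ y when y lies in the
-- part after x and is adjacent to x, or in the part before x and is not. This
-- makes G a 3-partite tournament, and curiousness says precisely that it has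
-- no cyclic triangle. Rank each vertex by the number of vertices from which it
-- is reachable. Arcs never decrease the rank, which gives the slice condition,
-- and an arc between vertices of equal rank lies on a cycle. A level cannot
-- meet all three parts: otherwise it contains a path a ⇒ m ⇒ b with pairwise
-- distinct colours; a shortest path back from b to a alternates between the
-- colours of b and a, and m, which dominates b, then dominates every vertex on
-- it, a included. So each level meets at most two parts, which are
-- independent, and is bipartite.
module Submission where

open import Defs hiding (sym)
open import Data.Nat using (ℕ; zero; suc; _≤_; _<_; z≤n)
open import Data.Nat.Properties using (≤-trans; ≤-<-trans; <⇒≢; 1+n≰n; ≤⇒≯)
import Data.Nat as ℕ
open import Data.Fin using (Fin; zero; suc; _≟_)
open import Data.Fin.Properties using (any?)
open import Data.Fin.Subset using (Subset; _∈_; _⊆_; ∣_∣)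
open import Data.Fin.Subset.Properties using (p⊆q⇒∣p∣≤∣q∣; p⊂q⇒∣p∣<∣q∣; ∣p∣≤n)
open import Data.Fin.Permutation using (id; _⟨$⟩ʳ_)
open import Data.Vec using (tabulate)
open import Data.Vec.Properties using (lookup∘tabulate; lookup⇒[]=; []=⇒lookup)
import Data.Bool as Bool
open import Data.Product using (_×_; _,_; proj₁; proj₂; ∃-syntax)
import Data.Product as Product
open import Data.Sum using (_⊎_; inj₁; inj₂)
import Data.Sum as Sum
open import Data.Empty using (⊥)
open import Function using (_∘_)
open import Relation.Nullary using (¬_; Dec; yes; no; does; ¬?; contradiction)
open import Relation.Nullary.Decidable using (_×-dec_; _⊎-dec_; dec-true; decidable-stable)
open import Relation.Binary.PropositionalEquality using (_≡_; _≢_; refl; sym; trans; cong)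
open import Relation.Binary.Construct.Closure.ReflexiveTransitive using (Star; ε; _◅_; _◅◅_)

module _ {n : ℕ} {P : Fin n → Set} (P? : ∀ x → Dec (P x)) where

  select : Subset n
  select = tabulate (λ x → does (P? x))

  ∈-select⁺ : ∀ {x} → P x → x ∈ select
  ∈-select⁺ {x} px = lookup⇒[]= x _ (trans (lookup∘tabulate _ x) (dec-true (P? x) px))

  ∈-select⁻ : ∀ {x} → x ∈ select → P x
  ∈-select⁻ {x} x∈ with P? x | trans (sym (lookup∘tabulate (λ x → does (P? x)) x)) ([]=⇒lookup x∈)
  ... | yes px | _  = px
  ... | no _   | ()

select-⊆ : ∀ {n} {P Q : Fin n → Set} (P? : ∀ x → Dec (P x)) (Q? : ∀ x → Dec (Q x)) →
           (∀ {x} → P x → Q x) → select P? ⊆ select Q?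
select-⊆ P? Q? P⇒Q = ∈-select⁺ Q? ∘ P⇒Q ∘ ∈-select⁻ P?

module Reachability {n : ℕ} {_⇒_ : Fin n → Fin n → Set} (_⇒?_ : ∀ x y → Dec (x ⇒ y)) where

  infix 4 _⇝[_]_ _⇝_

  _⇝[_]_ : Fin n → ℕ → Fin n → Set
  z ⇝[ zero  ] x = z ≡ x
  z ⇝[ suc k ] x = z ⇝[ k ] x ⊎ ∃[ w ] (z ⇝[ k ] w × w ⇒ x)

  ⇝[]? : ∀ k z x → Dec (z ⇝[ k ] x)
  ⇝[]? zero    z x = z ≟ x
  ⇝[]? (suc k) z x = ⇝[]? k z x ⊎-dec any? (λ w → ⇝[]? k z w ×-dec w ⇒? x)

  ⇝[]-refl : ∀ k {z} → z ⇝[ k ] z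
  ⇝[]-refl zero    = refl
  ⇝[]-refl (suc k) = inj₁ (⇝[]-refl k)

  ⇝[]⇒Star : ∀ k {z x} → z ⇝[ k ] x → Star _⇒_ z x
  ⇝[]⇒Star zero    refl                 = ε
  ⇝[]⇒Star (suc k) (inj₁ r)             = ⇝[]⇒Star k r
  ⇝[]⇒Star (suc k) (inj₂ (_ , r , w⇒x)) = ⇝[]⇒Star k r ◅◅ (w⇒x ◅ ε)

  Saturated : ℕ → Fin n → Set
  Saturated k z = ∀ {x} → z ⇝[ suc k ] x → z ⇝[ k ] x

  saturated-suc : ∀ {k z} → Saturated k z → Saturated (suc k) z
  saturated-suc sat (inj₁ r)             = r
  saturated-suc sat (inj₂ (w , r , w⇒x)) = inj₂ (w , sat r , w⇒x)

  reachableFrom : ℕ → Fin n → Subset n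
  reachableFrom k z = select (⇝[]? k z)

  saturated-or-grows : ∀ k z → Saturated k z ⊎ ∣ reachableFrom k z ∣ < ∣ reachableFrom (suc k) z ∣
  saturated-or-grows k z with any? (λ x → ⇝[]? (suc k) z x ×-dec ¬? (⇝[]? k z x))
  ... | yes (x , new , ¬old) =
    inj₂ (p⊂q⇒∣p∣<∣q∣ (select-⊆ (⇝[]? k z) (⇝[]? (suc k) z) inj₁ ,
                       x , ∈-select⁺ (⇝[]? (suc k) z) new , ¬old ∘ ∈-select⁻ (⇝[]? k z)))
  ... | no none = inj₁ λ {x} r → decidable-stable (⇝[]? k z x) (λ ¬old → none (x , r , ¬old))

  saturated-or-large : ∀ k z → Saturated k z ⊎ k ≤ ∣ reachableFrom k z ∣
  saturated-or-large zero    z = inj₂ z≤n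
  saturated-or-large (suc k) z with saturated-or-large k z | saturated-or-grows k z
  ... | inj₁ sat | _          = inj₁ (saturated-suc sat)
  ... | inj₂ _   | inj₁ sat   = inj₁ (saturated-suc sat)
  ... | inj₂ k≤  | inj₂ grows = inj₂ (≤-<-trans k≤ grows)

  saturated : ∀ z → Saturated (suc n) z
  saturated z with saturated-or-large (suc n) z
  ... | inj₁ sat   = sat
  ... | inj₂ large = contradiction (≤-trans large (∣p∣≤n (reachableFrom (suc n) z))) 1+n≰n

  _⇝_ : Fin n → Fin n → Set
  z ⇝ x = z ⇝[ suc n ] x

  ⇝-step : ∀ {z x y} → z ⇝ x → x ⇒ y → z ⇝ y
  ⇝-step {z} r x⇒y = saturated z (inj₂ (_ , r , x⇒y))

  _⇝?_ : ∀ z x → Dec (z ⇝ x)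
  _⇝?_ = ⇝[]? (suc n)

  reachersOf : Fin n → Subset n
  reachersOf x = select (_⇝? x)

  rank : Fin n → ℕ
  rank x = ∣ reachersOf x ∣

  reachers-mono : ∀ {x y} → x ⇒ y → reachersOf x ⊆ reachersOf y
  reachers-mono x⇒y = select-⊆ (_⇝? _) (_⇝? _) (λ r → ⇝-step r x⇒y)

  rank-mono : ∀ {x y} → x ⇒ y → rank x ≤ rank y
  rank-mono = p⊆q⇒∣p∣≤∣q∣ ∘ reachers-mono

  rank-≡⇒Star : ∀ {x y} → x ⇒ y → rank x ≡ rank y → Star _⇒_ y x
  rank-≡⇒Star {x} {y} x⇒y rx≡ry with y ⇝? x
  ... | yes y⇝x = ⇝[]⇒Star (suc n) y⇝x
  ... | no ¬y⇝x = contradiction rx≡ry (<⇒≢ (p⊂q⇒∣p∣<∣q∣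
          (reachers-mono x⇒y , y , ∈-select⁺ (_⇝? y) (⇝[]-refl (suc n)) , ¬y⇝x ∘ ∈-select⁻ (_⇝? x))))

module CyclicTriangleFree
  {n : ℕ} {C : Set} (_≟ᶜ_ : ∀ (c d : C) → Dec (c ≡ d)) (colour : Fin n → C)
  {_⇒_ : Fin n → Fin n → Set} (_⇒?_ : ∀ x y → Dec (x ⇒ y))
  (⇒-colours : ∀ {x y} → x ⇒ y → colour x ≢ colour y)
  (⇒-asym : ∀ {x y} → x ⇒ y → ¬ y ⇒ x)
  (⇒-total : ∀ {x y} → colour x ≢ colour y → x ⇒ y ⊎ y ⇒ x)
  (⇒-acyclic₃ : ∀ {x y z} → x ⇒ y → y ⇒ z → ¬ z ⇒ x)
  where

  open Reachability _⇒?_ public using (rank; rank-mono)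
  open Reachability _⇒?_ using (rank-≡⇒Star)

  ⇒-trans-≢ : ∀ {x y z} → x ⇒ y → y ⇒ z → colour x ≢ colour z → x ⇒ z
  ⇒-trans-≢ x⇒y y⇒z x≢z with ⇒-total x≢z
  ... | inj₁ x⇒z = x⇒z
  ... | inj₂ z⇒x = contradiction z⇒x (⇒-acyclic₃ x⇒y y⇒z)

  -- Zigzag c x z: a path from x whose vertices are coloured alternately colour x and c.
  data Zigzag : C → Fin n → Fin n → Set where
    []   : ∀ {c x} → Zigzag c x x
    step : ∀ {c x y z} → x ⇒ y → colour y ≡ c → Zigzag (colour x) y z → Zigzag c x z

  zigzag-cons : ∀ {c x y z} → x ⇒ y → Zigzag c y z → ∃[ d ] Zigzag d x z
  zigzag-cons x⇒y [] = _ , step x⇒y refl []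
  zigzag-cons {x = x} x⇒y (step {y = w} y⇒w _ P) with colour x ≟ᶜ colour w
  ... | yes x≡w = _ , step x⇒y refl (step y⇒w (sym x≡w) P)
  ... | no x≢w  = zigzag-cons (⇒-trans-≢ x⇒y y⇒w x≢w) P

  zigzag : ∀ {x z} → Star _⇒_ x z → ∃[ c ] Zigzag c x z
  zigzag {x} ε   = colour x , []
  zigzag (x⇒y ◅ P) = zigzag-cons x⇒y (proj₂ (zigzag P))

  zigzag-end : ∀ {c x z} → Zigzag c x z → colour z ≡ colour x ⊎ colour z ≡ c
  zigzag-end []              = inj₁ refl
  zigzag-end (step _ y≡c P) = Sum.swap (Sum.map₁ (λ z≡y → trans z≡y y≡c) (zigzag-end P))

  dominates-zigzag : ∀ {c m x z} → m ⇒ x → colour m ≢ c → Zigzag c x z → m ⇒ z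
  dominates-zigzag m⇒x m≢c []                 = m⇒x
  dominates-zigzag m⇒x m≢c (step x⇒y y≡c P) =
    dominates-zigzag (⇒-trans-≢ m⇒x x⇒y (m≢c ∘ λ m≡y → trans m≡y y≡c)) (⇒-colours m⇒x) P

  rainbow-path-leaves-level : ∀ {a m b} → a ⇒ m → m ⇒ b → rank a ≡ rank b → colour a ≢ colour b → ⊥
  rainbow-path-leaves-level {m = m} a⇒m m⇒b ra≡rb a≢b with ⇒-total a≢b
  ... | inj₂ b⇒a = ⇒-acyclic₃ a⇒m m⇒b b⇒a
  ... | inj₁ a⇒b with zigzag (rank-≡⇒Star a⇒b ra≡rb)
  ...   | c , b↝a = ⇒-asym a⇒m (dominates-zigzag m⇒b m≢c b↝a)
    where
    m≢c : colour m ≢ c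
    m≢c m≡c = Sum.[ a≢b , (λ a≡c → ⇒-colours a⇒m (trans a≡c (sym m≡c))) ] (zigzag-end b↝a)

  level-meets-at-most-two-colours : ∀ {u v w} → rank u ≡ rank v → rank v ≡ rank w →
    colour u ≢ colour v → colour v ≢ colour w → colour u ≢ colour w → ⊥
  level-meets-at-most-two-colours ru≡rv rv≡rw u≢v v≢w u≢w
    with ⇒-total u≢v | ⇒-total v≢w | ⇒-total u≢w
  ... | inj₁ u⇒v | inj₁ v⇒w | _        = rainbow-path-leaves-level u⇒v v⇒w (trans ru≡rv rv≡rw) u≢w
  ... | inj₂ v⇒u | inj₂ w⇒v | _        = rainbow-path-leaves-level w⇒v v⇒u (sym (trans ru≡rv rv≡rw)) (u≢w ∘ sym)
  ... | inj₁ u⇒v | inj₂ w⇒v | inj₁ u⇒w = rainbow-path-leaves-level u⇒w w⇒v ru≡rv u≢v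
  ... | inj₁ u⇒v | inj₂ w⇒v | inj₂ w⇒u = rainbow-path-leaves-level w⇒u u⇒v (sym rv≡rw) (v≢w ∘ sym)
  ... | inj₂ v⇒u | inj₁ v⇒w | inj₁ u⇒w = rainbow-path-leaves-level v⇒u u⇒w rv≡rw v≢w
  ... | inj₂ v⇒u | inj₁ v⇒w | inj₂ w⇒u = rainbow-path-leaves-level v⇒w w⇒u (sym ru≡rv) (u≢v ∘ sym)

next≢id : ∀ a → next a ≢ a
next≢id zero             = λ ()
next≢id (suc zero)       = λ ()
next≢id (suc (suc zero)) = λ ()

next²≢id : ∀ a → next (next a) ≢ a
next²≢id zero             = λ ()
next²≢id (suc zero)       = λ ()
next²≢id (suc (suc zero)) = λ ()

next³≡id : ∀ a → next (next (next a)) ≡ a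
next³≡id zero             = refl
next³≡id (suc zero)       = refl
next³≡id (suc (suc zero)) = refl

next-injective : ∀ {a b} → next a ≡ next b → a ≡ b
next-injective {a} {b} na≡nb = trans (sym (next³≡id a)) (trans (cong (next ∘ next) na≡nb) (next³≡id b))

≡next⇒≢ : ∀ {a b} → b ≡ next a → a ≢ b
≡next⇒≢ {a} b≡na a≡b = next≢id a (trans (sym b≡na) (sym a≡b))

≢⇒next⊎prev : ∀ {a b} → a ≢ b → b ≡ next a ⊎ a ≡ next b
≢⇒next⊎prev {zero}             {zero}             a≢b = contradiction refl a≢b
≢⇒next⊎prev {zero}             {suc zero}         a≢b = inj₁ refl
≢⇒next⊎prev {zero}             {suc (suc zero)}   a≢b = inj₂ refl
≢⇒next⊎prev {suc zero}         {zero}             a≢b = inj₂ refl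
≢⇒next⊎prev {suc zero}         {suc zero}         a≢b = contradiction refl a≢b
≢⇒next⊎prev {suc zero}         {suc (suc zero)}   a≢b = inj₁ refl
≢⇒next⊎prev {suc (suc zero)}   {zero}             a≢b = inj₁ refl
≢⇒next⊎prev {suc (suc zero)}   {suc zero}         a≢b = inj₂ refl
≢⇒next⊎prev {suc (suc zero)}   {suc (suc zero)}   a≢b = contradiction refl a≢b

≢⇒≡next² : ∀ {a m} → a ≢ m → a ≢ next m → a ≡ next (next m)
≢⇒≡next² {a} a≢m a≢nm with ≢⇒next⊎prev (a≢m ∘ sym)
... | inj₁ a≡nm = contradiction a≡nm a≢nm
... | inj₂ m≡na = trans (sym (next³≡id a)) (cong (next ∘ next) (sym m≡na))

cyclic-order : ∀ {a b c} → a ≢ b → b ≢ c → c ≢ a →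
               (b ≡ next a × c ≡ next b × a ≡ next c) ⊎ (a ≡ next b × b ≡ next c × c ≡ next a)
cyclic-order a≢b b≢c c≢a with ≢⇒next⊎prev a≢b | ≢⇒next⊎prev b≢c | ≢⇒next⊎prev c≢a
... | inj₁ b≡na | inj₁ c≡nb | inj₁ a≡nc = inj₁ (b≡na , c≡nb , a≡nc)
... | inj₂ a≡nb | inj₂ b≡nc | inj₂ c≡na = inj₂ (a≡nb , b≡nc , c≡na)
... | inj₁ b≡na | inj₁ c≡nb | inj₂ c≡na = contradiction (trans b≡na (sym c≡na)) b≢c
... | inj₁ b≡na | inj₂ b≡nc | _         = contradiction (next-injective (trans (sym b≡nc) b≡na)) c≢a
... | inj₂ a≡nb | inj₁ c≡nb | _         = contradiction (trans c≡nb (sym a≡nb)) c≢a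
... | inj₂ a≡nb | inj₂ b≡nc | inj₁ a≡nc = contradiction (next-injective (trans (sym a≡nb) a≡nc)) b≢c

next-colouring : ∀ {m a b} → a ≢ m → b ≢ m → does (a ≟ next m) ≡ does (b ≟ next m) → a ≡ b
next-colouring {m} {a} {b} a≢m b≢m same with a ≟ next m | b ≟ next m
next-colouring a≢m b≢m same | yes a≡nm | yes b≡nm = trans a≡nm (sym b≡nm)
next-colouring a≢m b≢m same | no a≢nm  | no b≢nm  = trans (≢⇒≡next² a≢m a≢nm) (sym (≢⇒≡next² b≢m b≢nm))
next-colouring a≢m b≢m ()   | yes _    | no _
next-colouring a≢m b≢m ()   | no _     | yes _

module Orientation {n : ℕ} (G : Graph n) (p : Partition3 n) where

  Edge? : ∀ x y → Dec (Edge G x y)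
  Edge? x y = adj G x y Bool.≟ Bool.true

  Edge-sym : ∀ {x y} → Edge G x y → Edge G y x
  Edge-sym {x} {y} = trans (Graph.sym G y x)

  Triangle-rotate : ∀ {x y z} → Triangle G x y z → Triangle G y z x
  Triangle-rotate (xy , xz , yz) = yz , Edge-sym xy , Edge-sym xz

  Edgeless3-rotate : ∀ {x y z} → Edgeless3 G x y z → Edgeless3 G y z x
  Edgeless3-rotate (¬xy , ¬xz , ¬yz) = ¬yz , ¬xy ∘ Edge-sym , ¬xz ∘ Edge-sym

  curious-rotated : Curious G p → ∀ {x y z} a → p x ≡ a → p y ≡ next a → p z ≡ next (next a) →
                    ¬ Triangle G x y z × ¬ Edgeless3 G x y z
  curious-rotated (_ , cur) {x} {y} {z} zero px py pz = cur x y z px py pz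
  curious-rotated (_ , cur) {x} {y} {z} (suc zero) px py pz =
    Product.map (_∘ Triangle-rotate ∘ Triangle-rotate) (_∘ Edgeless3-rotate ∘ Edgeless3-rotate)
                (cur z x y pz px py)
  curious-rotated (_ , cur) {x} {y} {z} (suc (suc zero)) px py pz =
    Product.map (_∘ Triangle-rotate) (_∘ Edgeless3-rotate) (cur y z x py pz px)

  infix 4 _⇒_ _⇒?_

  _⇒_ : Fin n → Fin n → Set
  x ⇒ y = (p y ≡ next (p x) × Edge G x y) ⊎ (p x ≡ next (p y) × ¬ Edge G x y)

  _⇒?_ : ∀ x y → Dec (x ⇒ y)
  x ⇒? y = (p y ≟ next (p x) ×-dec Edge? x y) ⊎-dec (p x ≟ next (p y) ×-dec ¬? (Edge? x y))

  ⇒-colours : ∀ {x y} → x ⇒ y → p x ≢ p y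
  ⇒-colours (inj₁ (y≡nx , _)) = ≡next⇒≢ y≡nx
  ⇒-colours (inj₂ (x≡ny , _)) = ≡next⇒≢ x≡ny ∘ sym

  ⇒-forward : ∀ {x y} → x ⇒ y → p y ≡ next (p x) → Edge G x y
  ⇒-forward (inj₁ (_ , e)) _ = e
  ⇒-forward {y = y} (inj₂ (x≡ny , _)) y≡nx =
    contradiction (sym (trans y≡nx (cong next x≡ny))) (next²≢id (p y))

  ⇒-backward : ∀ {x y} → x ⇒ y → p x ≡ next (p y) → ¬ Edge G x y
  ⇒-backward (inj₂ (_ , ¬e)) _ = ¬e
  ⇒-backward {x} (inj₁ (y≡nx , _)) x≡ny =
    contradiction (sym (trans x≡ny (cong next y≡nx))) (next²≢id (p x))

  ⇒-asym : ∀ {x y} → x ⇒ y → ¬ y ⇒ x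
  ⇒-asym (inj₁ (y≡nx , e))  y⇒x = ⇒-backward y⇒x y≡nx (Edge-sym e)
  ⇒-asym (inj₂ (x≡ny , ¬e)) y⇒x = ¬e (Edge-sym (⇒-forward y⇒x x≡ny))

  ⇒-total : ∀ {x y} → p x ≢ p y → x ⇒ y ⊎ y ⇒ x
  ⇒-total {x} {y} x≢y with ≢⇒next⊎prev x≢y | Edge? x y
  ... | inj₁ y≡nx | yes e  = inj₁ (inj₁ (y≡nx , e))
  ... | inj₁ y≡nx | no ¬e  = inj₂ (inj₂ (y≡nx , ¬e ∘ Edge-sym))
  ... | inj₂ x≡ny | yes e  = inj₂ (inj₁ (x≡ny , Edge-sym e))
  ... | inj₂ x≡ny | no ¬e  = inj₁ (inj₂ (x≡ny , ¬e))

  ⇒-acyclic₃ : Curious G p → ∀ {x y z} → x ⇒ y → y ⇒ z → ¬ z ⇒ x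
  ⇒-acyclic₃ cur {x} {z = z} x⇒y y⇒z z⇒x
    with cyclic-order (⇒-colours x⇒y) (⇒-colours y⇒z) (⇒-colours z⇒x)
  ... | inj₁ (y≡nx , z≡ny , x≡nz) =
    proj₁ (curious-rotated cur (p x) refl y≡nx (trans z≡ny (cong next y≡nx)))
          (⇒-forward x⇒y y≡nx , Edge-sym (⇒-forward z⇒x x≡nz) , ⇒-forward y⇒z z≡ny)
  ... | inj₂ (x≡ny , y≡nz , z≡nx) =
    proj₂ (curious-rotated cur (p z) refl y≡nz (trans x≡ny (cong next y≡nz)))
          (⇒-backward y⇒z y≡nz ∘ Edge-sym , ⇒-backward z⇒x z≡nx , ⇒-backward x⇒y x≡ny ∘ Edge-sym)

module Slicing {n : ℕ} (G : Graph n) (p : Partition3 n) (cur : Curious G p) where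

  open Orientation G p
  open CyclicTriangleFree _≟_ p _⇒?_ ⇒-colours ⇒-asym ⇒-total (⇒-acyclic₃ cur) public
    using (rank; rank-mono; level-meets-at-most-two-colours)

  ⇒-upwards : ∀ {x y} → rank x < rank y → p x ≢ p y → x ⇒ y
  ⇒-upwards rx<ry x≢y with ⇒-total x≢y
  ... | inj₁ x⇒y = x⇒y
  ... | inj₂ y⇒x = contradiction rx<ry (≤⇒≯ (rank-mono y⇒x))

  slice-assignment : SliceAssignment G (λ v → id ⟨$⟩ʳ p v) rank
  slice-assignment x y rx<ry = forward , backward
    where
    forward : p y ≡ next (p x) → Edge G x y
    forward y≡nx = ⇒-forward (⇒-upwards rx<ry (≡next⇒≢ y≡nx)) y≡nx

    backward : p y ≡ next (next (p x)) → ¬ Edge G x y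
    backward y≡nnx = ⇒-backward (⇒-upwards rx<ry (≡next⇒≢ x≡ny ∘ sym)) x≡ny
      where
      x≡ny : p x ≡ next (p y)
      x≡ny = trans (sym (next³≡id (p x))) (cong next (sym y≡nnx))

  missing-colour : ∀ j → ∃[ m ] (∀ v → rank v ≡ j → p v ≢ m)
  missing-colour j with any? (λ v → rank v ℕ.≟ j ×-dec p v ≟ i₃) | any? (λ v → rank v ℕ.≟ j ×-dec p v ≟ i₂)
  ... | no none₃ | _        = i₃ , λ v rv pv → none₃ (v , rv , pv)
  ... | yes _    | no none₂ = i₂ , λ v rv pv → none₂ (v , rv , pv)
  ... | yes (w₃ , r₃ , p₃) | yes (w₂ , r₂ , p₂) = i₁ , λ v rv p₁ →
    level-meets-at-most-two-colours (trans rv (sym r₂)) (trans r₂ (sym r₃))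
      (apart p₁ p₂ λ ()) (apart p₂ p₃ λ ()) (apart p₁ p₃ λ ())
    where
    apart : ∀ {u v a b} → p u ≡ a → p v ≡ b → a ≢ b → p u ≢ p v
    apart pu pv a≢b pu≡pv = a≢b (trans (sym pu) (trans pu≡pv pv))

  slices-bipartite : SlicesBipartite G rank
  slices-bipartite j with missing-colour j
  ... | m , no-m = (λ v → does (p v ≟ next m)) , λ x y rx ry e →
    (λ x≡y → proj₁ cur x y x≡y e) ∘ next-colouring (no-m x rx) (no-m y ry)

lemma12 : ∀ {n : ℕ} (G : Graph n) (p : Partition3 n) →
    Curious G p → (OfType G p 0 ⊎ OfType G p 1) → BipartiteSlicing G p
lemma12 G p cur _ = id , rank , slice-assignment , slices-bipartite
  where open Slicing G p cur
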